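{- For every function $f:\mathbb{N}\to\mathbb{N}$ satisfying $1\le f(n)\le n$ for all $n$, there is a family of connected graphs $\{G_n\}_{n\in\mathbb{N}}$ such that $G_n$ has $n$ vertices and $\mathrm{AC}(G_n)=\Theta(f(n))$.
   Context: Acquaintance time: for a connected graph, place one agent on each vertex. Two agents are acquainted once they occupy the two endpoints of a common edge at some time (including the initial placement). In each round one chooses a matching (set of pairwise vertex-disjoint edges, not necessarily maximal), and for every edge of it the two agents on its endpoints swap places. A strategy for acquaintance is a sequence of matchings after which every pair of agents has been acquainted; $\mathrm{AC}(G)$ is the minimum number of rounds in such a strategy. -}

module Defs where

open import Data.Nat using (ℕ; zero; suc; _≤_)
open import Data.Fin using (Fin)
open import Data.List using (List; []; _∷_; length)
open import Data.List.Membership.Propositional using (_∈_)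
open import Data.Product using (Σ; ∃; _×_; _,_)
open import Relation.Binary.PropositionalEquality using (_≡_; _≢_)
open import Relation.Nullary using (¬_)
open import Function using (id; _∘_)

record Graph (n : ℕ) : Set₁ where
  field
    Adj     : Fin n → Fin n → Set
    sym     : ∀ {u v} → Adj u v → Adj v u
    irrefl  : ∀ {v} → ¬ Adj v v
open Graph public

data Reach {n : ℕ} (G : Graph n) : Fin n → Fin n → Set where
  here : ∀ {v} → Reach G v v
  step : ∀ {u v w} → Adj G u v → Reach G v w → Reach G u w

Connected : ∀ {n} → Graph n → Set
Connected G = ∀ u v → Reach G u v

-- A matching of G, encoded as the involution of the vertex set that swaps the
-- endpoints of each matching edge and fixes every unmatched vertex.
record Matching {n : ℕ} (G : Graph n) : Set where
  field
    partner : Fin n → Fin n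
    invol   : ∀ v → partner (partner v) ≡ v
    isEdge  : ∀ v → partner v ≢ v → Adj G v (partner v)
open Matching public

-- A placement maps each vertex to the agent standing on it.
Placement : ℕ → Set
Placement n = Fin n → Fin n

-- The list of placements at times 0,1,...,k, starting from placement π and
-- applying the given matchings in order (agents on matched vertices swap).
configs : ∀ {n} {G : Graph n} → List (Matching G) → Placement n → List (Placement n)
configs [] π = π ∷ []
configs (M ∷ Ms) π = π ∷ configs Ms (π ∘ partner M)

-- Agents a and b are acquainted during the process given by Ms
-- (initial placement: agent v on vertex v).
Acquainted : ∀ {n} (G : Graph n) → List (Matching G) → Fin n → Fin n → Set
Acquainted {n} G Ms a b =
  Σ (Placement n) λ π → π ∈ configs Ms id ×
    (Σ (Fin n) λ u → Σ (Fin n) λ v → Adj G u v × π u ≡ a × π v ≡ b)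

IsStrategy : ∀ {n} (G : Graph n) → List (Matching G) → Set
IsStrategy G Ms = ∀ a b → a ≢ b → Acquainted G Ms a b

IsAC : ∀ {n} → Graph n → ℕ → Set
IsAC G m =
  (Σ (List (Matching G)) λ Ms → IsStrategy G Ms × length Ms ≡ m) ×
  (∀ Ms → IsStrategy G Ms → m ≤ length Ms)

module Submission where

-- The graphs are complete split graphs Split n s: a clique
-- K = {0,…,s-1}, and every other vertex is adjacent exactly to the vertices of K.
--
-- Key fact (split-AC): for n = D + 2 vertices and 1 ≤ s ≤ n, AC(Split n s) = ⌊D/s⌋.
--  * Lower bound: an acquainted pair always contains an agent standing on K, so
--    the agents that ever stand on K meet every pair of distinct agents and hence
--    number at least n - 1; after k rounds at most (k+1)s of them have stood on K.
--  * Upper bound ("sweep"): in round j the clique is swapped with the block of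
--    vertices [(j+1)s, (j+2)s).  Every agent except the last one thus reaches K
--    within ⌊D/s⌋ rounds, and an agent on K meets everybody.
-- The theorem then takes s = 1 + ⌊(n-2)/(f(n)+1)⌋, for which elementary
-- arithmetic on quotients gives ⌊(n-2)/s⌋ ≤ f(n) ≤ 3⌊(n-2)/s⌋ once n ≥ 3.

open import Defs
open import Data.Nat using (ℕ; suc; _≤_; _*_; zero; _<_; _+_; _∸_; z≤n; s≤s; s≤s⁻¹; z<s; _<?_; _≤?_; _/_; _%_; NonZero)
open import Data.Nat.Properties hiding (_≟_)
open import Data.Nat.DivMod using (result; _divMod_; m≡m%n+[m/n]*n; m%n<n; m/n*n≤m; m/n≤m; n/1≡n; m<n*o⇒m/o<n)
open import Data.Nat.Tactic.RingSolver using (solve-∀)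
open import Data.Fin using (Fin; zero; toℕ; fromℕ<; inject≤; _≟_)
open import Data.Fin.Properties using (toℕ-injective; toℕ<n; toℕ-fromℕ<; toℕ-inject≤; punchIn-injective; punchInᵢ≢i; injective⇒≤; all?; ¬∀⟶∃¬)
open import Data.Fin.Base using (punchIn)
open import Data.List using (List; []; _∷_; length; map; _++_; allFin; lookup)
open import Data.List.Properties using (length-map; length-++; length-tabulate)
open import Data.List.Membership.Propositional using (_∈_)
open import Data.List.Membership.Propositional.Properties using (∈-map⁺; ∈-++⁺ˡ; ∈-++⁺ʳ; ∈-allFin)
open import Data.List.Relation.Unary.Any using (here; there; index; any?)
open import Data.List.Relation.Unary.Any.Properties using (lookup-index)
open import Data.Product using (Σ; _×_; _,_; proj₂)
open import Data.Sum using (_⊎_; inj₁; inj₂)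
open import Data.Empty using (⊥-elim)
open import Function using (id; _∘_)
open import Function.Definitions using (StrictlySurjective)
open import Relation.Binary.PropositionalEquality using (_≡_; _≢_; refl; trans; cong; cong₂; subst; module ≡-Reasoning) renaming (sym to ≡sym)
open import Relation.Nullary using (¬_; Dec; yes; no; _×-dec_)

InClique : ∀ {n} → ℕ → Fin n → Set
InClique s v = toℕ v < s

Split : (n s : ℕ) → Graph n
Split n s = record
  { Adj    = λ u v → u ≢ v × (InClique s u ⊎ InClique s v)
  ; sym    = λ { (u≢v , inj₁ u∈K) → u≢v ∘ ≡sym , inj₂ u∈K
               ; (u≢v , inj₂ v∈K) → u≢v ∘ ≡sym , inj₁ v∈K }
  ; irrefl = λ (v≢v , _) → v≢v refl
  }

-- With a nonempty clique, vertex 0 is adjacent to every other vertex.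
split-connected : ∀ n s → 1 ≤ s → Connected (Split (suc n) s)
split-connected n s 1≤s u v with u ≟ v | u ≟ zero | v ≟ zero
... | yes refl | _        | _        = here
... | no u≢v   | yes refl | _        = step (u≢v , inj₁ 1≤s) here
... | no u≢v   | no _     | yes refl = step (u≢v , inj₂ 1≤s) here
... | no _     | no u≢0   | no v≢0   =
  step (u≢0 , inj₂ 1≤s) (step (v≢0 ∘ ≡sym , inj₁ 1≤s) here)

acquainted-sym : ∀ {n} (G : Graph n) Ms {a b} → Acquainted G Ms a b → Acquainted G Ms b a
acquainted-sym G Ms (π , π∈ , u , v , u~v , πu≡a , πv≡b) =
  π , π∈ , v , u , Graph.sym G u~v , πv≡b , πu≡a

module _ {n : ℕ} {G : Graph n} where

  length-configs : ∀ (Ms : List (Matching G)) π → length (configs Ms π) ≡ suc (length Ms)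
  length-configs []       π = refl
  length-configs (M ∷ Ms) π = cong suc (length-configs Ms (π ∘ partner M))

  rounds : (ℕ → Matching G) → ℕ → List (Matching G)
  rounds M zero    = []
  rounds M (suc k) = M 0 ∷ rounds (M ∘ suc) k

  length-rounds : ∀ M k → length (rounds M k) ≡ k
  length-rounds M zero    = refl
  length-rounds M (suc k) = cong suc (length-rounds (M ∘ suc) k)

  run : (ℕ → Matching G) → ℕ → Placement n → Placement n
  run M zero    π = π
  run M (suc t) π = run (M ∘ suc) t (π ∘ partner (M 0))

  run-∈ : ∀ M {t k} π → t ≤ k → run M t π ∈ configs (rounds M k) π
  run-∈ M {zero}  {zero}  π _         = here refl
  run-∈ M {zero}  {suc k} π _         = here refl
  run-∈ M {suc t} {suc k} π (s≤s t≤k) = there (run-∈ (M ∘ suc) (π ∘ partner (M 0)) t≤k)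

  run-arrive : ∀ M t π {a r} → (∀ i → i < t → partner (M i) a ≡ a) →
               partner (M t) r ≡ a → run M (suc t) π r ≡ π a
  run-arrive M zero    π fixed arrive = cong π arrive
  run-arrive M (suc t) π fixed arrive =
    trans (run-arrive (M ∘ suc) t (π ∘ partner (M 0)) (λ i i<t → fixed (suc i) (s≤s i<t)) arrive)
          (cong π (fixed 0 z<s))

  run-surjective : ∀ M t π → StrictlySurjective _≡_ π → StrictlySurjective _≡_ (run M t π)
  run-surjective M zero    π onto = onto
  run-surjective M (suc t) π onto = run-surjective (M ∘ suc) t (π ∘ partner (M 0)) onto′
    where
    onto′ : StrictlySurjective _≡_ (π ∘ partner (M 0))
    onto′ b with onto b
    ... | v , πv≡b = partner (M 0) v , trans (cong π (invol (M 0) v)) πv≡b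

all-but-one-length : ∀ {n} (L : List (Fin (suc n))) x → (∀ y → y ≢ x → y ∈ L) → n ≤ length L
all-but-one-length {n} L x ∈L = injective⇒≤ {f = position} position-injective
  where
  position : Fin n → Fin (length L)
  position i = index (∈L (punchIn x i) (punchInᵢ≢i x i))

  position-injective : ∀ {i j} → position i ≡ position j → i ≡ j
  position-injective {i} {j} same = punchIn-injective x i j (begin
    punchIn x i             ≡⟨ lookup-index (∈L (punchIn x i) (punchInᵢ≢i x i)) ⟩
    lookup L (position i)   ≡⟨ cong (lookup L) same ⟩
    lookup L (position j)   ≡⟨ lookup-index (∈L (punchIn x j) (punchInᵢ≢i x j)) ⟨
    punchIn x j             ∎)
    where open ≡-Reasoning

_∈?_ : ∀ {n} (y : Fin n) L → Dec (y ∈ L)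
y ∈? L = any? (y ≟_) L

-- A list meeting every pair of distinct elements of Fin (1 + n) misses at most
-- one element, hence has length ≥ n.
pair-cover-length : ∀ {n} (L : List (Fin (suc n))) →
                    (∀ x y → x ≢ y → x ∈ L ⊎ y ∈ L) → n ≤ length L
pair-cover-length {n} L meets with all? (_∈? L)
... | yes all∈L = all-but-one-length L zero (λ y _ → all∈L y)
... | no ¬all∈L with ¬∀⟶∃¬ (suc n) (_∈ L) (_∈? L) ¬all∈L
...   | x , x∉L = all-but-one-length L x other∈L
  where
  other∈L : ∀ y → y ≢ x → y ∈ L
  other∈L y y≢x with meets x y (y≢x ∘ ≡sym)
  ... | inj₁ x∈L = ⊥-elim (x∉L x∈L)
  ... | inj₂ y∈L = y∈L

module Visitors {n s : ℕ} (s≤n : s ≤ n) where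

  clique : List (Fin n)
  clique = map (λ i → inject≤ i s≤n) (allFin s)

  length-clique : length clique ≡ s
  length-clique = trans (length-map _ (allFin s)) (length-tabulate id)

  ∈-clique : ∀ u → InClique s u → u ∈ clique
  ∈-clique u u<s = subst (_∈ clique) (toℕ-injective toℕ-same)
                     (∈-map⁺ (λ i → inject≤ i s≤n) (∈-allFin (fromℕ< u<s)))
    where
    toℕ-same : toℕ (inject≤ (fromℕ< u<s) s≤n) ≡ toℕ u
    toℕ-same = trans (toℕ-inject≤ (fromℕ< u<s) s≤n) (toℕ-fromℕ< u<s)

  visitors : List (Placement n) → List (Fin n)
  visitors []       = []
  visitors (π ∷ πs) = map π clique ++ visitors πs

  length-visitors : ∀ πs → length (visitors πs) ≡ length πs * s
  length-visitors []       = refl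
  length-visitors (π ∷ πs) =
    trans (length-++ (map π clique))
          (cong₂ _+_ (trans (length-map π clique) length-clique) (length-visitors πs))

  ∈-visitors : ∀ {π πs u} → π ∈ πs → InClique s u → π u ∈ visitors πs
  ∈-visitors {π} (here refl) u∈K = ∈-++⁺ˡ (∈-map⁺ π (∈-clique _ u∈K))
  ∈-visitors {πs = π₀ ∷ _} (there π∈) u∈K = ∈-++⁺ʳ (map π₀ clique) (∈-visitors π∈ u∈K)

  acquainted⇒visitor : ∀ Ms {a b} → Acquainted (Split n s) Ms a b →
                       a ∈ visitors (configs Ms id) ⊎ b ∈ visitors (configs Ms id)
  acquainted⇒visitor Ms (π , π∈ , u , v , (_ , inj₁ u∈K) , refl , refl) = inj₁ (∈-visitors π∈ u∈K)
  acquainted⇒visitor Ms (π , π∈ , u , v , (_ , inj₂ v∈K) , refl , refl) = inj₂ (∈-visitors π∈ v∈K)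

strategy-length-lower : ∀ {n s} (s≤n : s ≤ suc n) Ms → IsStrategy (Split (suc n) s) Ms →
                        n ≤ suc (length Ms) * s
strategy-length-lower {n} {s} s≤n Ms strategy = begin
  n                                 ≤⟨ pair-cover-length L (λ x y x≢y → acquainted⇒visitor Ms (strategy x y x≢y)) ⟩
  length L                          ≡⟨ length-visitors (configs Ms id) ⟩
  length (configs Ms id) * s        ≡⟨ cong (_* s) (length-configs Ms id) ⟩
  suc (length Ms) * s               ∎
  where
  open Visitors s≤n
  open ≤-Reasoning
  L : List (Fin (suc n))
  L = visitors (configs Ms id)

-- The involution of {0,…,n-1} exchanging each r < s with r + T (when r + T < n),
-- for a shift T ≥ s; it becomes a matching of Split n s.
module BlockSwap (n s T : ℕ) (s≤T : s ≤ T) where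

  clique-below : ∀ {v} → v < s → ¬ T ≤ v
  clique-below v<s T≤v = <-irrefl refl (<-≤-trans v<s (≤-trans s≤T T≤v))

  data Role (v : ℕ) : Set where
    up   : v < s → v + T < n → Role v
    down : T ≤ v → v ∸ T < s → Role v
    stay : ¬ (v < s × v + T < n) → ¬ (T ≤ v × v ∸ T < s) → Role v

  role : ∀ v → Role v
  role v with v <? s ×-dec v + T <? n
  ... | yes (v<s , v+T<n) = up v<s v+T<n
  ... | no ¬up with T ≤? v ×-dec v ∸ T <? s
  ...   | yes (T≤v , v∸T<s) = down T≤v v∸T<s
  ...   | no ¬down = stay ¬up ¬down

  move : ∀ {v} → Role v → ℕ
  move {v} (up _ _)   = v + T
  move {v} (down _ _) = v ∸ T
  move {v} (stay _ _) = v

  blockSwap : ℕ → ℕ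
  blockSwap v = move (role v)

  blockSwap-up : ∀ {v} → v < s → v + T < n → blockSwap v ≡ v + T
  blockSwap-up {v} v<s v+T<n with role v
  ... | up _ _       = refl
  ... | down T≤v _   = ⊥-elim (clique-below v<s T≤v)
  ... | stay ¬up _   = ⊥-elim (¬up (v<s , v+T<n))

  blockSwap-down : ∀ {v} → T ≤ v → v ∸ T < s → blockSwap v ≡ v ∸ T
  blockSwap-down {v} T≤v v∸T<s with role v
  ... | up v<s _       = ⊥-elim (clique-below v<s T≤v)
  ... | down _ _       = refl
  ... | stay _ ¬down   = ⊥-elim (¬down (T≤v , v∸T<s))

  blockSwap-stay : ∀ {v} → ¬ (v < s × v + T < n) → ¬ (T ≤ v × v ∸ T < s) → blockSwap v ≡ v
  blockSwap-stay {v} ¬up ¬down with role v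
  ... | up v<s v+T<n   = ⊥-elim (¬up (v<s , v+T<n))
  ... | down T≤v v∸T<s = ⊥-elim (¬down (T≤v , v∸T<s))
  ... | stay _ _       = refl

  blockSwap-beyond : ∀ {v} → T + s ≤ v → blockSwap v ≡ v
  blockSwap-beyond {v} T+s≤v = blockSwap-stay
    (λ (v<s , _) → clique-below v<s (≤-trans (m≤m+n T s) T+s≤v))
    (λ (_ , v∸T<s) → <⇒≱ v∸T<s (subst (_≤ v ∸ T) (m+n∸m≡n T s) (∸-monoˡ-≤ T T+s≤v)))

  blockSwap-< : ∀ v → v < n → blockSwap v < n
  blockSwap-< v v<n with role v
  ... | up _ v+T<n = v+T<n
  ... | down _ _   = ≤-<-trans (m∸n≤m v T) v<n
  ... | stay _ _   = v<n

  blockSwap-involutive : ∀ v → v < n → blockSwap (blockSwap v) ≡ v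
  blockSwap-involutive v v<n with role v
  ... | up v<s _ =
    trans (blockSwap-down (m≤n+m T v) (subst (_< s) (≡sym (m+n∸n≡m v T)) v<s)) (m+n∸n≡m v T)
  ... | down T≤v v∸T<s =
    trans (blockSwap-up v∸T<s (subst (_< n) (≡sym (m∸n+n≡m T≤v)) v<n)) (m∸n+n≡m T≤v)
  ... | stay ¬up ¬down = blockSwap-stay ¬up ¬down

  blockSwap-clique : ∀ v → blockSwap v ≢ v → v < s ⊎ blockSwap v < s
  blockSwap-clique v moved with role v
  ... | up v<s _     = inj₁ v<s
  ... | down _ v∸T<s = inj₂ v∸T<s
  ... | stay _ _     = ⊥-elim (moved refl)

  partnerOf : Fin n → Fin n
  partnerOf v = fromℕ< (blockSwap-< (toℕ v) (toℕ<n v))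

  toℕ-partnerOf : ∀ v → toℕ (partnerOf v) ≡ blockSwap (toℕ v)
  toℕ-partnerOf v = toℕ-fromℕ< _

  matching : Matching (Split n s)
  matching = record
    { partner = partnerOf
    ; invol   = λ v → toℕ-injective (begin
        toℕ (partnerOf (partnerOf v))  ≡⟨ toℕ-partnerOf (partnerOf v) ⟩
        blockSwap (toℕ (partnerOf v))  ≡⟨ cong blockSwap (toℕ-partnerOf v) ⟩
        blockSwap (blockSwap (toℕ v))  ≡⟨ blockSwap-involutive (toℕ v) (toℕ<n v) ⟩
        toℕ v                          ∎)
    ; isEdge  = λ v moved → moved ∘ ≡sym ,
        inClique v (blockSwap-clique (toℕ v) (moved ∘ toℕ-injective ∘ trans (toℕ-partnerOf v)))
    }
    where
    open ≡-Reasoning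
    inClique : ∀ v → toℕ v < s ⊎ blockSwap (toℕ v) < s → InClique s v ⊎ InClique s (partnerOf v)
    inClique v (inj₁ v∈K)  = inj₁ v∈K
    inClique v (inj₂ pv<s) = inj₂ (subst (_< s) (≡sym (toℕ-partnerOf v)) pv<s)

-- The sweep strategy on Split (1 + n) (1 + s'): round j swaps the clique with the
-- block [(j+1)s, (j+2)s), so the agent starting at r + (t+1)s reaches clique
-- vertex r in round t and then meets every other agent.
module Sweep (n s' : ℕ) (s≤n : suc s' ≤ suc n) where

  s : ℕ
  s = suc s'

  G : Graph (suc n)
  G = Split (suc n) s

  module Round (j : ℕ) = BlockSwap (suc n) s (suc j * s) (m≤m+n s (j * s))

  sweep : ℕ → Matching G
  sweep j = Round.matching j

  enters-clique : ∀ t (r : Fin s) (a : Fin (suc n)) → toℕ a ≡ toℕ r + suc t * s →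
                  run sweep (suc t) id (inject≤ r s≤n) ≡ a
  enters-clique t r a a≡ = run-arrive sweep t id untouched arrives
    where
    open Round t

    -- Rounds i < t exchange the clique with blocks lying below a.
    untouched : ∀ i → i < t → partner (sweep i) a ≡ a
    untouched i i<t = toℕ-injective (trans (Round.toℕ-partnerOf i a) (Round.blockSwap-beyond i beyond))
      where
      beyond : suc i * s + s ≤ toℕ a
      beyond = begin
        suc i * s + s    ≡⟨ +-comm (suc i * s) s ⟩
        suc (suc i) * s  ≤⟨ *-monoˡ-≤ s (s≤s i<t) ⟩
        suc t * s        ≤⟨ m≤n+m (suc t * s) (toℕ r) ⟩
        toℕ r + suc t * s ≡⟨ a≡ ⟨
        toℕ a            ∎
        where open ≤-Reasoning

    arrives : partner (sweep t) (inject≤ r s≤n) ≡ a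
    arrives = toℕ-injective (begin
      toℕ (partnerOf (inject≤ r s≤n))  ≡⟨ toℕ-partnerOf (inject≤ r s≤n) ⟩
      blockSwap (toℕ (inject≤ r s≤n))  ≡⟨ cong blockSwap (toℕ-inject≤ r s≤n) ⟩
      blockSwap (toℕ r)                ≡⟨ blockSwap-up (toℕ<n r) (subst (_< suc n) a≡ (toℕ<n a)) ⟩
      toℕ r + suc t * s                ≡⟨ a≡ ⟨
      toℕ a                            ∎)
      where open ≡-Reasoning

  visits-clique : ∀ m (a : Fin (suc n)) → toℕ a < suc m * s →
                  Σ ℕ λ t → t ≤ m × Σ (Fin (suc n)) λ r → InClique s r × run sweep t id r ≡ a
  visits-clique m a a< with toℕ a divMod s
  ... | result zero r a≡ =
    0 , z≤n , a , subst (_< s) (≡sym (trans a≡ (+-identityʳ (toℕ r)))) (toℕ<n r) , refl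
  ... | result (suc t) r a≡ =
    suc t , t<m , inject≤ r s≤n , subst (_< s) (≡sym (toℕ-inject≤ r s≤n)) (toℕ<n r) ,
    enters-clique t r a a≡
    where
    t<m : suc t ≤ m
    t<m = s≤s⁻¹ (*-cancelʳ-< s (suc t) (suc m)
            (≤-<-trans (≤-trans (m≤n+m (suc t * s) (toℕ r)) (≤-reflexive (≡sym a≡))) a<))

  meets-everyone : ∀ {m} t → t ≤ m → ∀ r → InClique s r → ∀ b → run sweep t id r ≢ b →
                   Acquainted G (rounds sweep m) (run sweep t id r) b
  meets-everyone t t≤m r r∈K b r≢b with run-surjective sweep t id (λ b → b , refl) b
  ... | v , πv≡b = run sweep t id , run-∈ sweep id t≤m , r , v , (r≢v , inj₁ r∈K) , refl , πv≡b
    where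
    r≢v : r ≢ v
    r≢v refl = r≢b πv≡b

  acquainted-from : ∀ m a b → a ≢ b → toℕ a < suc m * s → Acquainted G (rounds sweep m) a b
  acquainted-from m a b a≢b a< with visits-clique m a a<
  ... | t , t≤m , r , r∈K , πr≡a =
    subst (λ x → Acquainted G (rounds sweep m) x b) πr≡a
          (meets-everyone t t≤m r r∈K b (a≢b ∘ trans (≡sym πr≡a)))

  -- If (m+1)s ≥ n, the first m rounds of the sweep form a strategy: of two
  -- distinct agents at most one is the last agent n.
  sweep-strategy : ∀ m → n ≤ suc m * s → IsStrategy G (rounds sweep m)
  sweep-strategy m cover a b a≢b with toℕ a <? n | toℕ b <? n
  ... | yes a<n | _       = acquainted-from m a b a≢b (<-≤-trans a<n cover)
  ... | no _    | yes b<n = acquainted-sym G _ (acquainted-from m b a (a≢b ∘ ≡sym) (<-≤-trans b<n cover))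
  ... | no a≮n  | no b≮n  = ⊥-elim (a≢b (toℕ-injective (trans (last a a≮n) (≡sym (last b b≮n)))))
    where
    last : ∀ (x : Fin (suc n)) → ¬ toℕ x < n → toℕ x ≡ n
    last x x≮n = ≤-antisym (s≤s⁻¹ (toℕ<n x)) (≮⇒≥ x≮n)

below-next-multiple : ∀ D s .{{_ : NonZero s}} → D < suc (D / s) * s
below-next-multiple D s = begin-strict
  D                  ≡⟨ m≡m%n+[m/n]*n D s ⟩
  D % s + D / s * s  <⟨ +-monoˡ-< (D / s * s) (m%n<n D s) ⟩
  s + D / s * s      ∎
  where open ≤-Reasoning

split-AC : ∀ D s' → suc s' ≤ 2 + D → IsAC (Split (2 + D) (suc s')) (D / suc s')
split-AC D s' s≤n =
  (rounds sweep m , sweep-strategy m (below-next-multiple D s) , length-rounds sweep m) ,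
  λ Ms strategy → s≤s⁻¹ (*-cancelʳ-< s m (suc (length Ms))
                    (≤-<-trans (m/n*n≤m D s) (strategy-length-lower s≤n Ms strategy)))
  where
  open Sweep (suc D) s' s≤n
  m : ℕ
  m = D / s

blockSize : ℕ → ℕ → ℕ
blockSize D F = suc (D / suc F)

blockSize-≤ : ∀ D F → blockSize D F ≤ 2 + D
blockSize-≤ D F = s≤s (≤-trans (m/n≤m D (suc F)) (n≤1+n D))

-- Since D < blockSize D F · (F + 1), the quotient D / blockSize D F is at most F.
rate-upper : ∀ D F → D / blockSize D F ≤ F
rate-upper D F = s≤s⁻¹ (m<n*o⇒m/o<n (subst (D <_) (*-comm (blockSize D F) (suc F))
                                           (below-next-multiple D (suc F))))

-- If (q+1)(F+1) ≤ D < (m+1)(q+2), then F ≤ 2m, because q + 2 ≤ 2(q + 1).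
quotient-lower : ∀ {D F q m} → suc q * suc F ≤ D → D < suc m * suc (suc q) → F ≤ m + m
quotient-lower {D} {F} {q} {m} below above =
  s≤s⁻¹ (subst (suc F ≤_) (+-suc m m) (s≤s⁻¹ F+1<2m+2))
  where
  swap-factors : ∀ m q → suc m * (suc q + suc q) ≡ suc q * (suc m + suc m)
  swap-factors = solve-∀

  F+1<2m+2 : suc F < suc m + suc m
  F+1<2m+2 = *-cancelˡ-< (suc q) (suc F) (suc m + suc m) (begin-strict
    suc q * suc F               ≤⟨ below ⟩
    D                           <⟨ above ⟩
    suc m * suc (suc q)         ≤⟨ *-monoʳ-≤ (suc m) (s≤s (m≤n+m (suc q) q)) ⟩
    suc m * (suc q + suc q)     ≡⟨ swap-factors m q ⟩
    suc q * (suc m + suc m)     ∎)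
    where open ≤-Reasoning

rate-lower : ∀ D F → 1 ≤ D → F ≤ 2 + D → F ≤ 3 * (D / blockSize D F)
rate-lower D F 1≤D F≤D+2 with D / suc F in q≡
... | zero = begin
  F              ≤⟨ F≤D+2 ⟩
  2 + D          ≡⟨ +-comm 2 D ⟩
  D + 2 * 1      ≤⟨ +-monoʳ-≤ D (*-monoʳ-≤ 2 1≤D) ⟩
  3 * D          ≡⟨ cong (3 *_) (n/1≡n D) ⟨
  3 * (D / 1)    ∎
  where open ≤-Reasoning
... | suc q = begin
  F              ≤⟨ quotient-lower {q = q} {m = m} below (below-next-multiple D (suc (suc q))) ⟩
  m + m          ≤⟨ +-monoʳ-≤ m (m≤m+n m (m + 0)) ⟩
  3 * m          ∎
  where
  open ≤-Reasoning
  m : ℕ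
  m = D / suc (suc q)
  below : suc q * suc F ≤ D
  below = subst (λ x → x * suc F ≤ D) q≡ (m/n*n≤m D (suc F))

proposition5p2 : (f : ℕ → ℕ) → (∀ n → 1 ≤ n → 1 ≤ f n × f n ≤ n) →
    Σ ((n : ℕ) → Graph n) λ G →
      (∀ n → 1 ≤ n → Connected (G n)) ×
      (Σ ℕ λ c → 1 ≤ c × Σ ℕ λ N → ∀ n → N ≤ n →
        Σ ℕ λ m → IsAC (G n) m × m ≤ c * f n × f n ≤ c * m)
proposition5p2 f f-bounded = family , connected , 3 , s≤s z≤n , 3 , Θ-bounds
  where
  family : (n : ℕ) → Graph n
  family n = Split n (blockSize (n ∸ 2) (f n))

  connected : ∀ n → 1 ≤ n → Connected (family n)
  connected (suc n) _ = split-connected n _ (s≤s z≤n)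

  Θ-bounds : ∀ n → 3 ≤ n → Σ ℕ λ m → IsAC (family n) m × m ≤ 3 * f n × f n ≤ 3 * m
  Θ-bounds n@(suc (suc D)) (s≤s (s≤s 1≤D)) =
    D / blockSize D (f n) ,
    split-AC D (D / suc (f n)) (blockSize-≤ D (f n)) ,
    ≤-trans (rate-upper D (f n)) (m≤m+n (f n) (2 * f n)) ,
    rate-lower D (f n) 1≤D (proj₂ (f-bounded n (s≤s z≤n)))
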